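{- Let $V$ be a finite set and let $S$ be a strong simple game on $V$ that is not a dictatorship. Then there exist three strong simple games $S_1,S_2,S_3$ on $V$, each having strictly more dummies than $S$, such that $S=m(S_1,S_2,S_3)$.
   Context: A game on a finite set $V$ is a family $S$ of subsets of $V$ (winning coalitions) that is upward closed. $S$ is strong if for every $A\subseteq V$, $A\in S$ or $V\setminus A\in S$; simple if no $A$ has both $A\in S$ and $V\setminus A\in S$. For $x\in V$, the dictatorship by $x$ is $\mathrm{Dict}_x=\{A\subseteq V: x\in A\}$. A voter $v\in V$ is a dummy of $S$ if $v$ belongs to no minimal winning coalition of $S$ (otherwise $v$ is powerful). The median of three games $S,T,U$ on $V$ is $m(S,T,U)=(S\cap T)\cup(S\cap U)\cup(T\cap U)$. -}

module Defs where

open import Data.Nat using (ℕ)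
open import Data.Bool using (Bool; true; false; _∧_; _∨_)
open import Data.Fin using (Fin)
open import Data.Fin.Subset using (Subset; _∈_; _∉_; _⊆_; ∁)
open import Data.Product using (Σ; ∃; _×_)
open import Data.Sum using (_⊎_)
open import Data.Empty using (⊥)
open import Relation.Nullary using (¬_)
open import Relation.Binary.PropositionalEquality using (_≡_; _≢_)
open import Function.Bundles using (_⇔_)

-- The finite voter set V is Fin n; coalitions are Subset n.
-- A family of coalitions is given by its (decidable) membership test.
Family : ℕ → Set
Family n = Subset n → Bool

Wins : ∀ {n} → Family n → Subset n → Set
Wins S A = S A ≡ true

IsGame : ∀ {n} → Family n → Set
IsGame {n} S = ∀ (A B : Subset n) → A ⊆ B → Wins S A → Wins S B

IsStrong : ∀ {n} → Family n → Set
IsStrong {n} S = ∀ (A : Subset n) → Wins S A ⊎ Wins S (∁ A)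

IsSimple : ∀ {n} → Family n → Set
IsSimple {n} S = ∀ (A : Subset n) → Wins S A → Wins S (∁ A) → ⊥

IsStrongSimpleGame : ∀ {n} → Family n → Set
IsStrongSimpleGame S = IsGame S × IsStrong S × IsSimple S

Dict : ∀ {n} → Fin n → Family n → Set
Dict {n} x S = ∀ (A : Subset n) → Wins S A ⇔ (x ∈ A)

IsDictatorship : ∀ {n} → Family n → Set
IsDictatorship {n} S = ∃ λ (x : Fin n) → Dict x S

MinimalWinning : ∀ {n} → Family n → Subset n → Set
MinimalWinning {n} S A =
  Wins S A × (∀ (B : Subset n) → B ⊆ A → B ≢ A → ¬ Wins S B)

Dummy : ∀ {n} → Family n → Fin n → Set
Dummy {n} S v = ∀ (A : Subset n) → MinimalWinning S A → v ∉ A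

IsDummySet : ∀ {n} → Family n → Subset n → Set
IsDummySet {n} S D = ∀ (v : Fin n) → (v ∈ D) ⇔ Dummy S v

median : ∀ {n} → Family n → Family n → Family n → Family n
median S T U A = (S A ∧ T A) ∨ (S A ∧ U A) ∨ (T A ∧ U A)

-- Choose three distinct powerful voters x, y, z and let S_xy be the game in
-- which x is forced to vote as y does.  Forcing a vote is monotone and commutes
-- with complementation, so S_xy is again strong and simple; x becomes a dummy
-- and every dummy of S stays one, so S_xy has strictly more dummies.  In any
-- coalition two of x, y, z vote alike, say x and y: then S_xy agrees with S,
-- while S_yz and S_zx either agree with S or deviate from it in opposite
-- directions, so the majority of the three is S.  Three powerful voters exist
-- because no singleton wins, so every minimal winning coalition has two members:
-- take x in one of them and y, z in one inside the complement of {x}.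
module Submission where

open import Defs
open import Data.Nat using (ℕ; _<_)
open import Data.Nat.Induction using (<-wellFounded)
open import Data.Bool using (Bool; true; false; not; _∧_; _∨_; _≤_; b≤b; f≤t)
  renaming (_≟_ to _≟ᵇ_)
open import Data.Bool.Properties using (≤-reflexive; ≤-minimum; ≤-maximum; ≤-antisym)
open import Data.Fin using (Fin; zero; suc; _≟_)
open import Data.Fin.Properties using (any?)
open import Data.Fin.Subset
  using (Subset; ∣_∣; _∈_; _∉_; _⊆_; _⊂_; ∁; ⁅_⁆; _-_; Nonempty)
  renaming (⊥ to ∅)
open import Data.Fin.Subset.Properties
  using (_∈?_; nonempty?; ⊆-refl; ⊆-trans; ⊆-antisym; ⊂-irref; p⊂q⇒∣p∣<∣q∣; p─⊥≡p; p─q⊆p;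
         x∈p⇒p-x⊂p; x∈p⇒∣p-x∣<∣p∣; x∈p∧x≢y⇒x∈p-y; x∈⁅x⁆; x∈⁅y⁆⇒x≡y; x∉⁅y⁆⇒x≢y;
         x∈∁p⇒x∉p; x∉p⇒x∈∁p)
open import Data.Vec using (_∷_; lookup; _[_]≔_)
open import Data.Vec.Properties
  using ([]=⇒lookup; lookup⇒[]=; lookup∘update; lookup∘update′; lookup-map; map-[]≔;
         []≔-lookup; []≔-idempotent; []≔-commutes)
open import Data.Product using (∃; ∃₂; _×_; _,_; proj₁)
open import Data.Sum using (_⊎_; inj₁; inj₂)
import Data.Sum as Sum
open import Data.Empty using (⊥-elim)
open import Function using (_∘_; id; _on_)
open import Function.Bundles using (mk⇔; module Equivalence)
open import Induction.WellFounded using (Acc; acc)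
open import Relation.Binary.Construct.On as On using ()
open import Relation.Nullary using (¬_; yes; no)
open import Relation.Nullary.Decidable using (_×-dec_; ¬?; decidable-stable)
open import Relation.Binary.PropositionalEquality
  using (_≡_; _≢_; refl; sym; trans; cong; subst; module ≡-Reasoning)

private
  variable
    n : ℕ
    A B : Subset n
    S : Family n
    x y v : Fin n

maj : Bool → Bool → Bool → Bool
maj a b c = (a ∧ b) ∨ (a ∧ c) ∨ (b ∧ c)

maj-rotate : ∀ a b c → maj a b c ≡ maj b c a
maj-rotate true  true  true  = refl
maj-rotate true  true  false = refl
maj-rotate true  false true  = refl
maj-rotate true  false false = refl
maj-rotate false true  true  = refl
maj-rotate false true  false = refl
maj-rotate false false true  = refl
maj-rotate false false false = refl

maj-between : ∀ {s p q} → p ≤ s → s ≤ q → maj s p q ≡ s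
maj-between {false} b≤b _   = refl
maj-between {true}  b≤b _   = refl
maj-between {true}  f≤t b≤b = refl

maj-between′ : ∀ {s p q} → q ≤ s → s ≤ p → maj s p q ≡ s
maj-between′ {false} {false} b≤b _ = refl
maj-between′ {false} {true}  b≤b _ = refl
maj-between′ {true}  b≤b b≤b = refl
maj-between′ {true}  f≤t b≤b = refl

two-of-three-agree : ∀ (a b c : Bool) → a ≡ b ⊎ b ≡ c ⊎ c ≡ a
two-of-three-agree true  true  _     = inj₁ refl
two-of-three-agree false false _     = inj₁ refl
two-of-three-agree true  false true  = inj₂ (inj₂ refl)
two-of-three-agree true  false false = inj₂ (inj₁ refl)
two-of-three-agree false true  true  = inj₂ (inj₁ refl)
two-of-three-agree false true  false = inj₂ (inj₂ refl)

⊆⇒lookup-≤ : A ⊆ B → ∀ i → lookup A i ≤ lookup B i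
⊆⇒lookup-≤ {A = A} A⊆B i with lookup A i in eq
... | false = ≤-minimum _
... | true  = ≤-reflexive (sym ([]=⇒lookup (A⊆B (lookup⇒[]= i A eq))))

lookup-≤⇒⊆ : (∀ i → lookup A i ≤ lookup B i) → A ⊆ B
lookup-≤⇒⊆ {B = B} le {i} i∈A =
  lookup⇒[]= i B (≤-antisym (≤-maximum _) (subst (_≤ lookup B i) ([]=⇒lookup i∈A) (le i)))

[]≔-mono : ∀ {a b} → A ⊆ B → a ≤ b → A [ x ]≔ a ⊆ B [ x ]≔ b
[]≔-mono {A = A} {B} {x} {a} {b} A⊆B a≤b = lookup-≤⇒⊆ pointwise
  where
  pointwise : ∀ i → lookup (A [ x ]≔ a) i ≤ lookup (B [ x ]≔ b) i
  pointwise i with i ≟ x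
  ... | yes refl rewrite lookup∘update i A a | lookup∘update i B b = a≤b
  ... | no i≢x rewrite lookup∘update′ i≢x A a | lookup∘update′ i≢x B b = ⊆⇒lookup-≤ A⊆B i

p-x≡p[x]≔false : ∀ (p : Subset n) x → p - x ≡ p [ x ]≔ false
p-x≡p[x]≔false (_ ∷ p) zero    = cong (false ∷_) (p─⊥≡p p)
p-x≡p[x]≔false (b ∷ p) (suc x) = cong (b ∷_) (p-x≡p[x]≔false p x)

p⊆q∧p≢q⇒p⊂q : A ⊆ B → A ≢ B → A ⊂ B
p⊆q∧p≢q⇒p⊂q {A = A} {B} A⊆B A≢B with any? (λ u → u ∈? B ×-dec ¬? (u ∈? A))
... | yes witness = A⊆B , witness
... | no none     = ⊥-elim (A≢B (⊆-antisym A⊆B B⊆A))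
  where
  B⊆A : B ⊆ A
  B⊆A {u} u∈B = decidable-stable (u ∈? A) (λ u∉A → none (u , u∈B , u∉A))

p⊆q∧x∉p⇒p⊆q-x : A ⊆ B → x ∉ A → A ⊆ B - x
p⊆q∧x∉p⇒p⊆q-x A⊆B x∉A i∈A = x∈p∧x≢y⇒x∈p-y (A⊆B i∈A) λ { refl → x∉A i∈A }

copyVote : Fin n → Fin n → Subset n → Subset n
copyVote x y A = A [ x ]≔ lookup A y

copyVote-mono : A ⊆ B → copyVote x y A ⊆ copyVote x y B
copyVote-mono {y = y} A⊆B = []≔-mono A⊆B (⊆⇒lookup-≤ A⊆B y)

copyVote-∁ : ∀ x y (A : Subset n) → copyVote x y (∁ A) ≡ ∁ (copyVote x y A)
copyVote-∁ x y A = begin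
  ∁ A [ x ]≔ lookup (∁ A) y    ≡⟨ cong (∁ A [ x ]≔_) (lookup-map y not A) ⟩
  ∁ A [ x ]≔ not (lookup A y)  ≡⟨ sym (map-[]≔ not A x) ⟩
  ∁ (A [ x ]≔ lookup A y)      ∎
  where open ≡-Reasoning

copyVote-agreeing : lookup A x ≡ lookup A y → copyVote x y A ≡ A
copyVote-agreeing {A = A} {x} e = trans (cong (A [ x ]≔_) (sym e)) ([]≔-lookup A x)

copyVote-outside-⊆ : lookup A y ≡ false → copyVote x y A ⊆ A
copyVote-outside-⊆ {A = A} {y} {x} e =
  subst (copyVote x y A ⊆_) ([]≔-lookup A x)
        ([]≔-mono ⊆-refl (subst (_≤ lookup A x) (sym e) (≤-minimum _)))

copyVote-inside-⊇ : lookup A y ≡ true → A ⊆ copyVote x y A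
copyVote-inside-⊇ {A = A} {y} {x} e =
  subst (_⊆ copyVote x y A) ([]≔-lookup A x)
        ([]≔-mono ⊆-refl (subst (lookup A x ≤_) (sym e) (≤-maximum _)))

copyVote-remove-source : y ≢ x → ∀ (A : Subset n) → copyVote x y (A - x) ≡ copyVote x y A
copyVote-remove-source {y = y} {x} y≢x A = begin
  copyVote x y (A - x)
    ≡⟨ cong (copyVote x y) (p-x≡p[x]≔false A x) ⟩
  (A [ x ]≔ false) [ x ]≔ lookup (A [ x ]≔ false) y
    ≡⟨ cong (A [ x ]≔ false [ x ]≔_) (lookup∘update′ y≢x A false) ⟩
  (A [ x ]≔ false) [ x ]≔ lookup A y
    ≡⟨ []≔-idempotent A x ⟩
  copyVote x y A
    ∎
  where open ≡-Reasoning

copyVote-remove-other : v ≢ x → v ≢ y → ∀ (A : Subset n) → copyVote x y (A - v) ≡ copyVote x y A - v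
copyVote-remove-other {v = v} {x} {y} v≢x v≢y A = begin
  copyVote x y (A - v)
    ≡⟨ cong (copyVote x y) (p-x≡p[x]≔false A v) ⟩
  (A [ v ]≔ false) [ x ]≔ lookup (A [ v ]≔ false) y
    ≡⟨ cong (A [ v ]≔ false [ x ]≔_) (lookup∘update′ (v≢y ∘ sym) A false) ⟩
  (A [ v ]≔ false) [ x ]≔ lookup A y
    ≡⟨ []≔-commutes A v x v≢x ⟩
  copyVote x y A [ v ]≔ false
    ≡⟨ sym (p-x≡p[x]≔false (copyVote x y A) v) ⟩
  copyVote x y A - v
    ∎
  where open ≡-Reasoning

game-mono : IsGame S → A ⊆ B → S A ≤ S B
game-mono {S = S} {A} {B} G A⊆B with S A in eq
... | false = ≤-minimum _
... | true  = ≤-reflexive (sym (G A B A⊆B eq))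

strongSimpleGame-∘ : (f : Subset n → Subset n) → (∀ {A B} → A ⊆ B → f A ⊆ f B)
                   → (∀ A → f (∁ A) ≡ ∁ (f A))
                   → IsStrongSimpleGame S → IsStrongSimpleGame (S ∘ f)
strongSimpleGame-∘ {S = S} f mono f-∁ (G , St , Si) =
    (λ A B A⊆B → G (f A) (f B) (mono A⊆B))
  , (λ A → Sum.map₂ (subst (Wins S) (sym (f-∁ A))) (St (f A)))
  , (λ A w w′ → Si (f A) w (subst (Wins S) (f-∁ A) w′))

minimalWinning-⊆ : IsGame S → Wins S A → ∃ λ C → C ⊆ A × MinimalWinning S C
minimalWinning-⊆ {S = S} {A} G = shrink A (On.wellFounded ∣_∣ <-wellFounded A)
  where
  shrink : ∀ A → Acc (_<_ on ∣_∣) A → Wins S A → ∃ λ C → C ⊆ A × MinimalWinning S C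
  shrink A (acc smaller) wA with any? (λ u → u ∈? A ×-dec (S (A - u) ≟ᵇ true))
  ... | yes (u , u∈A , wA-u) =
    let C , C⊆A-u , minC = shrink (A - u) (smaller (x∈p⇒∣p-x∣<∣p∣ u∈A)) wA-u
    in  C , ⊆-trans C⊆A-u (p─q⊆p A ⁅ u ⁆) , minC
  ... | no irreducible = A , ⊆-refl , wA , minimal
    where
    minimal : ∀ B → B ⊆ A → B ≢ A → ¬ Wins S B
    minimal B B⊆A B≢A wB =
      let _ , u , u∈A , u∉B = p⊆q∧p≢q⇒p⊂q B⊆A B≢A
      in  irreducible (u , u∈A , G B (A - u) (p⊆q∧x∉p⇒p⊆q-x B⊆A u∉B) wB)

Removable : Family n → Fin n → Set
Removable {n} S v = ∀ (A : Subset n) → Wins S A → Wins S (A - v)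

removable⇒dummy : Removable S v → Dummy S v
removable⇒dummy {v = v} removable A (wA , minA) v∈A =
  minA (A - v) (p─q⊆p A ⁅ v ⁆) (λ eq → ⊂-irref eq (x∈p⇒p-x⊂p v∈A)) (removable A wA)

dummy⇒removable : IsGame S → Dummy S v → Removable S v
dummy⇒removable {v = v} G dummy A wA =
  let C , C⊆A , minC = minimalWinning-⊆ G wA
  in  G C (A - v) (p⊆q∧x∉p⇒p⊆q-x C⊆A (dummy C minC)) (proj₁ minC)

singletonWins⇒Dict : IsGame S → IsSimple S → Wins S ⁅ x ⁆ → Dict x S
singletonWins⇒Dict {S = S} {x} G Si w A = mk⇔ to from
  where
  from : x ∈ A → Wins S A
  from x∈A = G ⁅ x ⁆ A (λ i∈ → subst (_∈ A) (sym (x∈⁅y⁆⇒x≡y x i∈)) x∈A) w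
  to : Wins S A → x ∈ A
  to wA = decidable-stable (x ∈? A) λ x∉A →
    Si A wA (G ⁅ x ⁆ (∁ A) (λ i∈ → x∉p⇒x∈∁p (subst (_∉ A) (sym (x∈⁅y⁆⇒x≡y x i∈)) x∉A)) w)

winning-nonempty : IsGame S → IsSimple S → Wins S A → Nonempty A
winning-nonempty {A = A} G Si wA with nonempty? A
... | yes ne   = ne
... | no empty = ⊥-elim (Si A wA (G A (∁ A) (λ {i} i∈A → ⊥-elim (empty (i , i∈A))) wA))

winning-two-members : IsGame S → IsSimple S → ¬ IsDictatorship S → Wins S A
                    → ∃₂ λ y z → y ∈ A × z ∈ A × y ≢ z
winning-two-members {A = A} G Si nd wA
  with y , y∈A ← winning-nonempty G Si wA
  with any? (λ z → z ∈? A ×-dec ¬? (z ≟ y))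
... | yes (z , z∈A , z≢y) = y , z , y∈A , z∈A , z≢y ∘ sym
... | no none = ⊥-elim (nd (y , singletonWins⇒Dict G Si (G A ⁅ y ⁆ A⊆⁅y⁆ wA)))
  where
  A⊆⁅y⁆ : A ⊆ ⁅ y ⁆
  A⊆⁅y⁆ {z} z∈A =
    subst (_∈ ⁅ y ⁆) (sym (decidable-stable (z ≟ y) λ z≢y → none (z , z∈A , z≢y))) (x∈⁅x⁆ y)

three-powerful-voters : IsStrongSimpleGame S → ¬ IsDictatorship S
  → ∃ λ x → ∃ λ y → ∃ λ z → ¬ Dummy S x × ¬ Dummy S y × ¬ Dummy S z × x ≢ y × y ≢ z × z ≢ x
three-powerful-voters {S = S} (G , St , Si) nd =
  let _ , wW                     = someWinning
      M , _ , minM               = minimalWinning-⊆ G wW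
      x , x∈M                    = winning-nonempty G Si (proj₁ minM)
      M′ , M′⊆∁⁅x⁆ , minM′       = minimalWinning-⊆ G (∁⁅x⁆-wins x)
      y , z , y∈M′ , z∈M′ , y≢z  = winning-two-members G Si nd (proj₁ minM′)
      ≢x : ∀ {u} → u ∈ M′ → u ≢ x
      ≢x u∈M′ = x∉⁅y⁆⇒x≢y (x∈∁p⇒x∉p (M′⊆∁⁅x⁆ u∈M′))
  in  x , y , z , (λ d → d M minM x∈M) , (λ d → d M′ minM′ y∈M′) , (λ d → d M′ minM′ z∈M′)
    , ≢x y∈M′ ∘ sym , y≢z , ≢x z∈M′
  where
  someWinning : ∃ (Wins S)
  someWinning = Sum.[ (∅ ,_) , (∁ ∅ ,_) ] (St ∅)
  ∁⁅x⁆-wins : ∀ x → Wins S (∁ ⁅ x ⁆)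
  ∁⁅x⁆-wins x = Sum.[ (λ w → ⊥-elim (nd (x , singletonWins⇒Dict G Si w))) , id ] (St ⁅ x ⁆)

copyVote-strongSimpleGame : ∀ x y → IsStrongSimpleGame S → IsStrongSimpleGame (S ∘ copyVote x y)
copyVote-strongSimpleGame x y = strongSimpleGame-∘ (copyVote x y) copyVote-mono (copyVote-∁ x y)

copyVote-source-dummy : y ≢ x → Dummy (S ∘ copyVote x y) x
copyVote-source-dummy {S = S} y≢x =
  removable⇒dummy λ A → subst (Wins S) (sym (copyVote-remove-source y≢x A))

copyVote-keeps-dummy : IsGame S → Dummy S v → v ≢ x → v ≢ y → Dummy (S ∘ copyVote x y) v
copyVote-keeps-dummy {S = S} {x = x} {y} G dummy v≢x v≢y = removable⇒dummy λ A wA →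
  subst (Wins S) (sym (copyVote-remove-other v≢x v≢y A)) (dummy⇒removable G dummy (copyVote x y A) wA)

copyVote-more-dummies : IsGame S → x ≢ y → ¬ Dummy S x → ¬ Dummy S y
  → ∀ (D D′ : Subset n) → IsDummySet S D → IsDummySet (S ∘ copyVote x y) D′ → ∣ D ∣ < ∣ D′ ∣
copyVote-more-dummies {S = S} {x = x} G x≢y ¬dx ¬dy D D′ isD isD′ =
  p⊂q⇒∣p∣<∣q∣ (D⊆D′ , x , from (isD′ x) (copyVote-source-dummy {S = S} (x≢y ∘ sym)) , ¬dx ∘ to (isD x))
  where
  open Equivalence
  D⊆D′ : D ⊆ D′
  D⊆D′ {v} v∈D =
    let dv = to (isD v) v∈D
    in  from (isD′ v) (copyVote-keeps-dummy G dv (λ { refl → ¬dx dv }) (λ { refl → ¬dy dv }))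

copyVote-weakens : IsGame S → lookup A y ≡ false → S (copyVote x y A) ≤ S A
copyVote-weakens G e = game-mono G (copyVote-outside-⊆ e)

copyVote-strengthens : IsGame S → lookup A y ≡ true → S A ≤ S (copyVote x y A)
copyVote-strengthens G e = game-mono G (copyVote-inside-⊇ e)

-- If x and y agree on A, the first game is S itself at A, and the other two
-- move away from S A in the directions given by the votes of z and x.
majority-copyVote-agreeing : IsGame S → ∀ x y z A → lookup A x ≡ lookup A y
  → S A ≡ maj (S (copyVote x y A)) (S (copyVote y z A)) (S (copyVote z x A))
majority-copyVote-agreeing {S = S} G x y z A x~y = begin
  S A                                   ≡⟨ sym (by-votes (lookup A x) (lookup A z) refl refl) ⟩
  maj (S A) syz szx                     ≡⟨ cong (λ s → maj s syz szx) (sym (cong S (copyVote-agreeing x~y))) ⟩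
  maj (S (copyVote x y A)) syz szx      ∎
  where
  open ≡-Reasoning
  syz = S (copyVote y z A)
  szx = S (copyVote z x A)
  syz≡S-A : lookup A x ≡ lookup A z → syz ≡ S A
  syz≡S-A x~z = cong S (copyVote-agreeing (trans (sym x~y) x~z))
  by-votes : ∀ bx bz → lookup A x ≡ bx → lookup A z ≡ bz → maj (S A) syz szx ≡ S A
  by-votes true  true  ex ez =
    maj-between (≤-reflexive (syz≡S-A (trans ex (sym ez)))) (copyVote-strengthens G ex)
  by-votes true  false ex ez = maj-between (copyVote-weakens G ez) (copyVote-strengthens G ex)
  by-votes false true  ex ez = maj-between′ (copyVote-weakens G ex) (copyVote-strengthens G ez)
  by-votes false false ex ez =
    maj-between′ (copyVote-weakens G ex) (≤-reflexive (sym (syz≡S-A (trans ex (sym ez)))))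

median-copyVote : IsGame S → ∀ x y z A
  → S A ≡ median (S ∘ copyVote x y) (S ∘ copyVote y z) (S ∘ copyVote z x) A
median-copyVote {S = S} G x y z A =
  by-agreeing-pair (two-of-three-agree (lookup A x) (lookup A y) (lookup A z))
  where
  sxy = S (copyVote x y A)
  syz = S (copyVote y z A)
  szx = S (copyVote z x A)
  by-agreeing-pair : lookup A x ≡ lookup A y ⊎ lookup A y ≡ lookup A z ⊎ lookup A z ≡ lookup A x
                   → S A ≡ maj sxy syz szx
  by-agreeing-pair (inj₁ x~y) = majority-copyVote-agreeing G x y z A x~y
  by-agreeing-pair (inj₂ (inj₁ y~z)) =
    trans (majority-copyVote-agreeing G y z x A y~z) (sym (maj-rotate sxy syz szx))
  by-agreeing-pair (inj₂ (inj₂ z~x)) =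
    trans (majority-copyVote-agreeing G z x y A z~x) (maj-rotate szx sxy syz)

lemma2 : ∀ (n : ℕ) (S : Family n)
    → IsStrongSimpleGame S
    → ¬ IsDictatorship S
    → ∃ λ (S₁ : Family n) → ∃ λ (S₂ : Family n) → ∃ λ (S₃ : Family n)
        → IsStrongSimpleGame S₁ × IsStrongSimpleGame S₂ × IsStrongSimpleGame S₃
        × (∀ (D D₁ : Subset n) → IsDummySet S D → IsDummySet S₁ D₁ → ∣ D ∣ < ∣ D₁ ∣)
        × (∀ (D D₂ : Subset n) → IsDummySet S D → IsDummySet S₂ D₂ → ∣ D ∣ < ∣ D₂ ∣)
        × (∀ (D D₃ : Subset n) → IsDummySet S D → IsDummySet S₃ D₃ → ∣ D ∣ < ∣ D₃ ∣)
        × (∀ (A : Subset n) → S A ≡ median S₁ S₂ S₃ A)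
lemma2 n S ssg@(G , _) nd =
  let x , y , z , ¬dx , ¬dy , ¬dz , x≢y , y≢z , z≢x = three-powerful-voters ssg nd
  in  S ∘ copyVote x y , S ∘ copyVote y z , S ∘ copyVote z x
    , copyVote-strongSimpleGame x y ssg
    , copyVote-strongSimpleGame y z ssg
    , copyVote-strongSimpleGame z x ssg
    , copyVote-more-dummies G x≢y ¬dx ¬dy
    , copyVote-more-dummies G y≢z ¬dy ¬dz
    , copyVote-more-dummies G z≢x ¬dz ¬dx
    , median-copyVote G x y z
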